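{- Let $A=(a_1,\ldots,a_n)\in\mathbb{Z}^n$ with each $a_i\ne0$, $\gcd(a_1,\ldots,a_n)=1$, and containing both positive and negative entries, and let $\boldsymbol{\alpha}=(\alpha_1,\ldots,\alpha_n)$ with $\alpha_i=|a_i|$. Let $i_0\ne i_1$ in $\{1,\ldots,n\}$ be such that $\alpha_{i_0}$ and $\alpha_{i_1}$ are the two largest entries of $\boldsymbol{\alpha}$ (possibly equal). Then \[ \gamma_0^{\mathbb{S}^1}(A)=\frac{s_{(n-2,n-2,n-3,\ldots,1,0)}(\boldsymbol{\alpha})}{s_{(n-1,n-2,n-3,\ldots,1,0)}(\boldsymbol{\alpha})}\le\frac{1}{\alpha_{i_0}+\alpha_{i_1}}. \]
   Context: $s_\mu$ denotes the Schur polynomial in $n$ variables associated to the partition $\mu$ (sum of monomials $\prod x_{T_{i,j}}$ over semistandard Young tableaux $T$ of shape $\mu$ with entries in $\{1,\ldots,n\}$). The quantity $\gamma_0^{\mathbb{S}^1}(A)$ is the first Laurent coefficient at $t=1$ of the Hilbert series of the graded algebra of real regular functions on the linear symplectic quotient of the unitary $\mathbb{S}^1$-representation with weight vector $A$, which is known to equal the displayed ratio of Schur polynomials. -}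

module Defs where

open import Data.Nat using (ℕ; zero; suc; _+_; _*_; _∸_; _≤ᵇ_; _<ᵇ_)
open import Data.Nat.GCD using (gcd)
open import Data.Fin using (Fin; toℕ)
open import Data.Bool using (Bool; true; false; _∧_)
open import Data.List using (List; []; _∷_; map; concat; concatMap; allFin;
  downFrom; drop; filter; zipWith; foldr)
open import Data.Nat.ListAction using (sum; product)
open import Data.Bool.ListAction using (and)
open import Data.Integer using (ℤ; ∣_∣)
open import Relation.Nullary.Decidable using (yes; no)
open import Relation.Binary.PropositionalEquality using (_≡_)
open import Data.Bool using (T?)

words : (n k : ℕ) → List (List (Fin n))
words n zero    = [] ∷ []
words n (suc k) = concatMap (λ i → map (i ∷_) (words n k)) (allFin n)

-- all fillings of a (Young diagram of) shape μ, given by its row lengths,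
-- with entries in Fin n (= {1,…,n}); a filling is the list of its rows
fillings : (n : ℕ) → List ℕ → List (List (List (Fin n)))
fillings n []       = [] ∷ []
fillings n (k ∷ μ)  =
  concatMap (λ r → map (r ∷_) (fillings n μ)) (words n k)

rowWeak : ∀ {n} → List (Fin n) → Bool
rowWeak []             = true
rowWeak (a ∷ [])       = true
rowWeak (a ∷ b ∷ r)    = (toℕ a ≤ᵇ toℕ b) ∧ rowWeak (b ∷ r)

colStrict : ∀ {n} → List (Fin n) → List (Fin n) → Bool
colStrict upper lower = and (zipWith (λ a b → toℕ a <ᵇ toℕ b) upper lower)

isSSYT : ∀ {n} → List (List (Fin n)) → Bool
isSSYT []              = true
isSSYT (r ∷ [])        = rowWeak r
isSSYT (r ∷ s ∷ rs)    = rowWeak r ∧ colStrict r s ∧ isSSYT (s ∷ rs)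

weight : ∀ {n} → (Fin n → ℕ) → List (List (Fin n)) → ℕ
weight x T = product (map x (concat T))

schur : (n : ℕ) → List ℕ → (Fin n → ℕ) → ℕ
schur n μ x = sum (map (weight x) (filter (λ T → T? (isSSYT T)) (fillings n μ)))

staircase : ℕ → List ℕ
staircase n = downFrom n

shapeNum : ℕ → List ℕ
shapeNum n = (n ∸ 2) ∷ drop 1 (downFrom n)

gcdVec : ∀ {n} → (Fin n → ℤ) → ℕ
gcdVec {n} A = foldr (λ i g → gcd ∣ A i ∣ g) 0 (allFin n)

module Submission where

-- Only i₀ ≢ i₁ is used: the inequality holds with any x ∈ ℕⁿ in place of ∣A∣ and any p ≠ q in place
-- of i₀, i₁, so the hypotheses on A (nonzero entries, gcd 1, both signs, maximality) are not needed.
--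
-- Schur polynomials of partitions are symmetric.  In a semistandard tableau, the entries of a row
-- that equal i or i+1 and are not forced by the neighbouring rows form a block; the Bender–Knuth
-- involution reflects the number of entries ≤ i of each row inside the interval of values the
-- neighbours allow, which swaps the numbers of entries i and i+1.  So s_ν(x) is invariant under
-- exchanging x_i and x_{i+1}, and we may assume that p and q are the last two indices n−2, n−1.
--
-- For ν = (a, a, μ) the first row of a semistandard tableau is entrywise below the second row of the
-- same length, so its entries are at most n−2, and appending n−2 or n−1 to it gives a semistandard
-- tableau of shape ν⁺ = (a+1, a, μ).  The two injections have disjoint images and multiply the weight
-- by x_{n−2} and x_{n−1}, whence s_ν(x) (x_{n−2} + x_{n−1}) ≤ s_{ν⁺}(x).  The theorem is the case
-- a = n−2, μ = (n−3, …, 1, 0).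

open import Defs

-- A separate module, so that the ℕ-order _<_ used throughout does not clash with the ℤ-order _<_
-- of the statement.
module Schur where

  open import Data.Bool using (true; false; T; if_then_else_; _∧_)
  open import Data.Bool.Properties using (T-∧)
  open import Data.Empty using (⊥-elim)
  open import Data.Fin as Fin using (Fin; toℕ)
  open import Data.Fin.Permutation.Components using (transpose)
  open import Data.Fin.Properties using (toℕ<n; toℕ-injective; toℕ-fromℕ<; toℕ-fromℕ; toℕ-inject₁)
  open import Data.List
    using (List; []; _∷_; _++_; map; concat; concatMap; filter; length; replicate; allFin; downFrom;
           cartesianProductWith)
  open import Data.List.Membership.Propositional using (_∈_)
  open import Data.List.Membership.Propositional.Properties
    using (∈-allFin; ∈-map⁻; ∈-map⁺; ∈-cartesianProductWith⁺; ∈-cartesianProductWith⁻)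
  open import Data.List.Membership.Propositional.Properties.WithK using (unique∧set⇒bag)
  open import Data.List.Properties
    using (map-∘; map-cong; map-cong-local; map-++; ∷-injective; length-++; length-replicate; ++-identityʳ;
           filter-idem; filter-++; filter-all; filter-none; filter-accept; filter-reject)
  open import Data.List.Relation.Binary.BagAndSetEquality using (∼bag⇒↭)
  open import Data.List.Relation.Binary.Permutation.Propositional using (_↭_)
  import Data.List.Relation.Binary.Permutation.Propositional.Properties as Perm
  open import Data.List.Relation.Unary.All as All using (All; []; _∷_)
  import Data.List.Relation.Unary.All.Properties as Allₚ
  open import Data.List.Relation.Unary.AllPairs using (AllPairs; []; _∷_)
  import Data.List.Relation.Unary.AllPairs.Properties as AllPairs
  open import Data.List.Relation.Unary.Any using (here; there)
  open import Data.List.Relation.Unary.Linked using (Linked; []; [-]; _∷_; linked?)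
  open import Data.List.Relation.Unary.Linked.Properties using (AllPairs⇒Linked; Linked⇒AllPairs)
  open import Data.List.Relation.Unary.Unique.Propositional using (Unique)
  import Data.List.Relation.Unary.Unique.Propositional.Properties as Unique
  open import Data.Nat
    using (ℕ; zero; suc; _+_; _*_; _∸_; _^_; _⊔_; _⊓_; _≤_; _<_; _≥_; z≤n; s≤s;
           _≤ᵇ_; _<ᵇ_; _<?_; _≤?_; _≥?_)
  open import Data.Nat.ListAction using (sum; product)
  open import Data.Nat.ListAction.Properties using (sum-++; sum-↭; product-++)
  open import Data.Nat.Properties
  open import Algebra.Properties.CommutativeSemigroup +-commutativeSemigroup using (interchange)
  open import Data.Nat.Solver using (module +-*-Solver)
  open import Data.Product using (_×_; _,_; proj₁; proj₂; ∃; uncurry; <_,_>)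
  open import Data.Sum using (_⊎_; inj₁; inj₂)
  open import Function using (_∘_; flip; _⇔_; mk⇔; Equivalence)
  open import Relation.Binary.Definitions using (tri<; tri≈; tri>)
  open import Relation.Binary.PropositionalEquality
    using (_≡_; _≢_; refl; sym; trans; cong; cong₂; subst; subst₂; module ≡-Reasoning)
  open import Relation.Nullary using (¬_; Dec; yes; no)
  open import Relation.Nullary.Decidable using (T?; map′; _×-dec_; dec-true; dec-false)

  open +-*-Solver using (solve; _:+_; _:*_; _:=_; con)

  module _ {A : Set} where

    sum-map-mono : ∀ {f g : A → ℕ} {xs} → All (λ x → f x ≤ g x) xs → sum (map f xs) ≤ sum (map g xs)
    sum-map-mono []            = z≤n
    sum-map-mono (fx≤gx ∷ f≤g) = +-mono-≤ fx≤gx (sum-map-mono f≤g)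

    sum-map-*ʳ : ∀ (f : A → ℕ) c xs → sum (map f xs) * c ≡ sum (map (λ x → f x * c) xs)
    sum-map-*ʳ f c []       = refl
    sum-map-*ʳ f c (x ∷ xs) = trans (*-distribʳ-+ c (f x) _) (cong (f x * c +_) (sum-map-*ʳ f c xs))

    sum-map-≥-single : ∀ (f : A → ℕ) {x xs} → x ∈ xs → f x ≤ sum (map f xs)
    sum-map-≥-single f (here refl)                = m≤m+n _ _
    sum-map-≥-single f {xs = y ∷ _} (there x∈) = ≤-trans (sum-map-≥-single f x∈) (m≤n+m _ (f y))

    sum-map-≥-pair : ∀ (f : A → ℕ) {x y xs} → x ∈ xs → y ∈ xs → x ≢ y → f x + f y ≤ sum (map f xs)
    sum-map-≥-pair f (here refl) (here refl) x≢y = ⊥-elim (x≢y refl)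
    sum-map-≥-pair f (here refl) (there y∈)  _   = +-monoʳ-≤ _ (sum-map-≥-single f y∈)
    sum-map-≥-pair f {x} {y} {.y ∷ xs} (there x∈) (here refl) _ =
      subst (_≤ f y + sum (map f xs)) (+-comm (f y) (f x)) (+-monoʳ-≤ (f y) (sum-map-≥-single f x∈))
    sum-map-≥-pair f {xs = z ∷ _} (there x∈) (there y∈) x≢y =
      ≤-trans (sum-map-≥-pair f x∈ y∈ x≢y) (m≤n+m _ (f z))

    sum-map-involution : ∀ (f : A → A) (g : A → ℕ) {xs} → Unique xs → (∀ x → f (f x) ≡ x) →
                         (∀ {x} → x ∈ xs → f x ∈ xs) → sum (map (g ∘ f) xs) ≡ sum (map g xs)
    sum-map-involution f g {xs} xs! f∘f≡id f-closed =
      trans (cong sum (map-∘ xs)) (sum-↭ (Perm.map⁺ g map-f-xs↭xs))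
      where
      f-injective : ∀ {x y} → f x ≡ f y → x ≡ y
      f-injective {x} {y} fx≡fy = trans (sym (f∘f≡id x)) (trans (cong f fx≡fy) (f∘f≡id y))
      same-elements : ∀ {x} → (x ∈ map f xs) ⇔ (x ∈ xs)
      same-elements {x} = mk⇔
        (λ x∈ → let (y , y∈ , x≡fy) = ∈-map⁻ f x∈ in subst (_∈ xs) (sym x≡fy) (f-closed y∈))
        (λ x∈ → subst (_∈ map f xs) (f∘f≡id x) (∈-map⁺ f (f-closed x∈)))
      map-f-xs↭xs : map f xs ↭ xs
      map-f-xs↭xs = ∼bag⇒↭ (unique∧set⇒bag (Unique.map⁺ f-injective xs!) xs! same-elements)

  module _ {A : Set} (y : A → ℕ) where

    product-map-++ : ∀ xs ys → product (map y (xs ++ ys)) ≡ product (map y xs) * product (map y ys)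
    product-map-++ xs ys = trans (cong product (map-++ y xs ys)) (product-++ (map y xs) _)

    product-map-replicate : ∀ a e → product (map y (replicate a e)) ≡ y e ^ a
    product-map-replicate zero    e = refl
    product-map-replicate (suc a) e = cong (y e *_) (product-map-replicate a e)

  module _ {A B C : Set} (f : A → B → C) where

    concatMap≡cartesianProductWith : ∀ xs ys → concatMap (λ x → map (f x) ys) xs ≡ cartesianProductWith f xs ys
    concatMap≡cartesianProductWith []       ys = refl
    concatMap≡cartesianProductWith (x ∷ xs) ys = cong (map (f x) ys ++_) (concatMap≡cartesianProductWith xs ys)

    sum-map-cartesianProductWith : ∀ (g : C → ℕ) xs ys →
      sum (map g (cartesianProductWith f xs ys)) ≡ sum (map (λ x → sum (map (λ y → g (f x y)) ys)) xs)
    sum-map-cartesianProductWith g []       ys = refl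
    sum-map-cartesianProductWith g (x ∷ xs) ys = begin
      sum (map g (map (f x) ys ++ cartesianProductWith f xs ys))
        ≡⟨ cong sum (map-++ g (map (f x) ys) _) ⟩
      sum (map g (map (f x) ys) ++ map g (cartesianProductWith f xs ys))
        ≡⟨ sum-++ (map g (map (f x) ys)) _ ⟩
      sum (map g (map (f x) ys)) + sum (map g (cartesianProductWith f xs ys))
        ≡⟨ cong₂ _+_ (cong sum (sym (map-∘ ys))) (sum-map-cartesianProductWith g xs ys) ⟩
      sum (map (λ y → g (f x y)) ys) + sum (map (λ x → sum (map (λ y → g (f x y)) ys)) xs) ∎
      where open ≡-Reasoning

  T-∧⁻ : ∀ x {y} → T (x ∧ y) → T x × T y
  T-∧⁻ x = Equivalence.to (T-∧ {x})

  T-∧⁺ : ∀ x {y} → T x → T y → T (x ∧ y)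
  T-∧⁺ x p q = Equivalence.from (T-∧ {x}) (p , q)

  m⊔n+n⊓m≡m+n : ∀ m n → m ⊔ n + n ⊓ m ≡ m + n
  m⊔n+n⊓m≡m+n zero    n       = trans (cong (n +_) (⊓-zeroʳ n)) (+-identityʳ n)
  m⊔n+n⊓m≡m+n (suc m) zero    = refl
  m⊔n+n⊓m≡m+n (suc m) (suc n) =
    cong suc (trans (+-suc (m ⊔ n) (n ⊓ m)) (trans (cong suc (m⊔n+n⊓m≡m+n m n)) (sym (+-suc m n))))

  [m∸n]+[o∸m]≡o∸n : ∀ {m n o} → n ≤ m → m ≤ o → (m ∸ n) + (o ∸ m) ≡ o ∸ n
  [m∸n]+[o∸m]≡o∸n {m} {n} {o} n≤m m≤o = begin
    (m ∸ n) + (o ∸ m) ≡⟨ +-comm (m ∸ n) (o ∸ m) ⟩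
    (o ∸ m) + (m ∸ n) ≡⟨ +-∸-assoc (o ∸ m) n≤m ⟨
    (o ∸ m) + m ∸ n   ≡⟨ cong (_∸ n) (m∸n+n≡m m≤o) ⟩
    o ∸ n             ∎
    where open ≡-Reasoning

  ≢-suc⇒≤⊎≥ : ∀ {v k} → v ≢ suc k → v ≤ k ⊎ suc (suc k) ≤ v
  ≢-suc⇒≤⊎≥ {v} {k} v≢k+1 with <-cmp v (suc k)
  ... | tri< v<k+1 _ _ = inj₁ (≤-pred v<k+1)
  ... | tri≈ _ v≡k+1 _ = ⊥-elim (v≢k+1 v≡k+1)
  ... | tri> _ _ k+1<v = inj₂ k+1<v

  reflect : ℕ → ℕ → ℕ → ℕ
  reflect lo hi m = lo + hi ∸ m

  module _ {lo hi m : ℕ} (lo≤m : lo ≤ m) (m≤hi : m ≤ hi) where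

    private
      m≤lo+hi : m ≤ lo + hi
      m≤lo+hi = ≤-trans m≤hi (m≤n+m hi lo)

    reflect+m≡lo+hi : reflect lo hi m + m ≡ lo + hi
    reflect+m≡lo+hi = m∸n+n≡m m≤lo+hi

    reflect-involutive : reflect lo hi (reflect lo hi m) ≡ m
    reflect-involutive = m∸[m∸n]≡n m≤lo+hi

    lo≤reflect : lo ≤ reflect lo hi m
    lo≤reflect = subst (lo ≤_) (sym (+-∸-assoc lo m≤hi)) (m≤m+n lo (hi ∸ m))

    reflect≤hi : reflect lo hi m ≤ hi
    reflect≤hi = subst (reflect lo hi m ≤_) (m+n∸m≡n lo hi) (∸-monoʳ-≤ (lo + hi) lo≤m)

  -- The inductive step of #i-bkRows, with the truncated differences P = m ∸ a and Q = c ∸ b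
  -- given by their defining equations.
  telescope-step : ∀ {P Q X Y a b c d m M H N} → P + a ≡ m → Q + b ≡ c → m + b ≡ M + H → M + N ≡ a + d →
                   X + d ≡ Y + N → P + X + c ≡ Q + Y + H
  telescope-step {P} {Q} {X} {Y} {a} {b} {c} {d} {m} {M} {H} {N} P+a Q+b m+b M+N X+d =
    +-cancelʳ-≡ (a + b + d) _ _ (begin
      P + X + c + (a + b + d)   ≡⟨ solve 6 (λ P X c a b d → P :+ X :+ c :+ (a :+ b :+ d)
                                                      := P :+ a :+ b :+ (X :+ d) :+ c) refl P X c a b d ⟩
      P + a + b + (X + d) + c   ≡⟨ cong₂ (λ u v → u + b + v + c) P+a X+d ⟩
      m + b + (Y + N) + c       ≡⟨ cong (λ u → u + (Y + N) + c) m+b ⟩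
      M + H + (Y + N) + c       ≡⟨ solve 5 (λ M H Y N c → M :+ H :+ (Y :+ N) :+ c
                                                    := M :+ N :+ (H :+ Y :+ c)) refl M H Y N c ⟩
      M + N + (H + Y + c)       ≡⟨ cong (_+ (H + Y + c)) M+N ⟩
      a + d + (H + Y + c)       ≡⟨ cong (λ u → a + d + (H + Y + u)) Q+b ⟨
      a + d + (H + Y + (Q + b)) ≡⟨ solve 6 (λ a d H Y Q b → a :+ d :+ (H :+ Y :+ (Q :+ b))
                                                      := Q :+ Y :+ H :+ (a :+ b :+ d)) refl a d H Y Q b ⟩
      Q + Y + H + (a + b + d)   ∎)
    where open ≡-Reasoning

  module _ {n : ℕ} where

    words-suc : ∀ k → words n (suc k) ≡ cartesianProductWith _∷_ (allFin n) (words n k)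
    words-suc k = concatMap≡cartesianProductWith _∷_ (allFin n) (words n k)

    fillings-∷ : ∀ k μ → fillings n (k ∷ μ) ≡ cartesianProductWith _∷_ (words n k) (fillings n μ)
    fillings-∷ k μ = concatMap≡cartesianProductWith _∷_ (words n k) (fillings n μ)

    ∈-words⁻ : ∀ k {w} → w ∈ words n k → length w ≡ k
    ∈-words⁻ zero    (here refl) = refl
    ∈-words⁻ (suc k) w∈
      with _ , _ , _ , w∈′ , refl ← ∈-cartesianProductWith⁻ _∷_ (allFin n) (words n k)
                                       (subst (_ ∈_) (words-suc k) w∈)
      = cong suc (∈-words⁻ k w∈′)

    ∈-words⁺ : ∀ (w : List (Fin n)) → w ∈ words n (length w)
    ∈-words⁺ []      = here refl
    ∈-words⁺ (e ∷ w) = subst (_ ∈_) (sym (words-suc (length w)))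
      (∈-cartesianProductWith⁺ _∷_ (∈-allFin e) (∈-words⁺ w))

    words-unique : ∀ k → Unique (words n k)
    words-unique zero    = [] ∷ []
    words-unique (suc k) = subst Unique (sym (words-suc k))
      (Unique.cartesianProductWith⁺ _∷_ ∷-injective (Unique.allFin⁺ n) (words-unique k))

    ∈-fillings⁻ : ∀ μ {t} → t ∈ fillings n μ → map length t ≡ μ
    ∈-fillings⁻ []      (here refl) = refl
    ∈-fillings⁻ (k ∷ μ) t∈
      with _ , _ , w∈ , t∈′ , refl ← ∈-cartesianProductWith⁻ _∷_ (words n k) (fillings n μ)
                                       (subst (_ ∈_) (fillings-∷ k μ) t∈)
      = cong₂ _∷_ (∈-words⁻ k w∈) (∈-fillings⁻ μ t∈′)

    ∈-fillings⁺ : ∀ (t : List (List (Fin n))) → t ∈ fillings n (map length t)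
    ∈-fillings⁺ []      = here refl
    ∈-fillings⁺ (w ∷ t) = subst (_ ∈_) (sym (fillings-∷ (length w) (map length t)))
      (∈-cartesianProductWith⁺ _∷_ (∈-words⁺ w) (∈-fillings⁺ t))

    fillings-unique : ∀ μ → Unique (fillings n μ)
    fillings-unique []      = [] ∷ []
    fillings-unique (k ∷ μ) = subst Unique (sym (fillings-∷ k μ))
      (Unique.cartesianProductWith⁺ _∷_ ∷-injective (words-unique k) (fillings-unique μ))

    sum-words-suc : ∀ a (g : List (Fin n) → ℕ) →
      sum (map g (words n (suc a))) ≡ sum (map (λ w → sum (map (λ v → g (w ++ v ∷ [])) (allFin n))) (words n a))
    sum-words-suc zero g = begin
      sum (map g (words n 1))
        ≡⟨ cong (sum ∘ map g) (words-suc 0) ⟩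
      sum (map g (cartesianProductWith _∷_ (allFin n) ([] ∷ [])))
        ≡⟨ sum-map-cartesianProductWith _∷_ g (allFin n) _ ⟩
      sum (map (λ v → g (v ∷ []) + 0) (allFin n))
        ≡⟨ cong sum (map-cong (λ v → +-identityʳ _) (allFin n)) ⟩
      sum (map (λ v → g (v ∷ [])) (allFin n))
        ≡⟨ +-identityʳ _ ⟨
      sum (map (λ v → g (v ∷ [])) (allFin n)) + 0
        ∎
      where open ≡-Reasoning
    sum-words-suc (suc a) g = begin
      sum (map g (words n (2 + a)))
        ≡⟨ cong (sum ∘ map g) (words-suc (suc a)) ⟩
      sum (map g (cartesianProductWith _∷_ (allFin n) (words n (suc a))))
        ≡⟨ sum-map-cartesianProductWith _∷_ g (allFin n) (words n (suc a)) ⟩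
      sum (map (λ e → sum (map (λ w → g (e ∷ w)) (words n (suc a)))) (allFin n))
        ≡⟨ cong sum (map-cong (λ e → sum-words-suc a (g ∘ (e ∷_))) (allFin n)) ⟩
      sum (map (λ e → sum (map (λ w → h (e ∷ w)) (words n a))) (allFin n))
        ≡⟨ sum-map-cartesianProductWith _∷_ h (allFin n) (words n a) ⟨
      sum (map h (cartesianProductWith _∷_ (allFin n) (words n a)))
        ≡⟨ cong (sum ∘ map h) (words-suc a) ⟨
      sum (map h (words n (suc a)))
        ∎
      where
      open ≡-Reasoning
      h : List (Fin n) → ℕ
      h w = sum (map (λ v → g (w ++ v ∷ [])) (allFin n))

  Row : ℕ → Set
  Row n = List (Fin n)

  Tableau : ℕ → Set
  Tableau n = List (Row n)

  weight-∷ : ∀ {n} (x : Fin n → ℕ) r t → weight x (r ∷ t) ≡ product (map x r) * weight x t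
  weight-∷ x r t = product-map-++ x r (concat t)

  ssytWeight : ∀ {n} → (Fin n → ℕ) → Tableau n → ℕ
  ssytWeight x t = if isSSYT t then weight x t else 0

  ssytWeight-ssyt : ∀ {n} (x : Fin n → ℕ) t → T (isSSYT t) → ssytWeight x t ≡ weight x t
  ssytWeight-ssyt x t ssyt with isSSYT t
  ... | true = refl

  ssytWeight-¬ssyt : ∀ {n} (x : Fin n → ℕ) t → ¬ T (isSSYT t) → ssytWeight x t ≡ 0
  ssytWeight-¬ssyt x t ¬ssyt with isSSYT t
  ... | true  = ⊥-elim (¬ssyt _)
  ... | false = refl

  schur≡sum-ssytWeight : ∀ n μ (x : Fin n → ℕ) → schur n μ x ≡ sum (map (ssytWeight x) (fillings n μ))
  schur≡sum-ssytWeight n μ x = sum-filter (fillings n μ)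
    where
    sum-filter : ∀ ts → sum (map (weight x) (filter (λ t → T? (isSSYT t)) ts)) ≡ sum (map (ssytWeight x) ts)
    sum-filter []       = refl
    sum-filter (t ∷ ts) with isSSYT t
    ... | true  = cong (weight x t +_) (sum-filter ts)
    ... | false = sum-filter ts

  module _ {n : ℕ} where

    below : ℕ → Row n → Row n
    below v = filter (λ e → toℕ e <? v)

    count< : ℕ → Row n → ℕ
    count< v r = length (below v r)

    below-∷-< : ∀ {v e} r → toℕ e < v → below v (e ∷ r) ≡ e ∷ below v r
    below-∷-< r = filter-accept (λ e → toℕ e <? _) {xs = r}

    below-∷-≥ : ∀ {v e} r → v ≤ toℕ e → below v (e ∷ r) ≡ below v r
    below-∷-≥ r v≤e = filter-reject (λ e → toℕ e <? _) {xs = r} (≤⇒≯ v≤e)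

    below≡[] : ∀ {v r} → All (λ e → v ≤ toℕ e) r → below v r ≡ []
    below≡[] v≤r = filter-none _ (All.map ≤⇒≯ v≤r)

    below-++-≥ : ∀ {v} xs {ys} → All (λ e → v ≤ toℕ e) ys → below v (xs ++ ys) ≡ below v xs
    below-++-≥ {v} xs {ys} v≤ys = begin
      below v (xs ++ ys)       ≡⟨ filter-++ _ xs ys ⟩
      below v xs ++ below v ys ≡⟨ cong (below v xs ++_) (below≡[] v≤ys) ⟩
      below v xs ++ []         ≡⟨ ++-identityʳ _ ⟩
      below v xs               ∎
      where open ≡-Reasoning

    count<-∷-< : ∀ {v e} r → toℕ e < v → count< v (e ∷ r) ≡ suc (count< v r)
    count<-∷-< r e<v = cong length (below-∷-< r e<v)

    count<-∷-≥ : ∀ {v e} r → v ≤ toℕ e → count< v (e ∷ r) ≡ count< v r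
    count<-∷-≥ r v≤e = cong length (below-∷-≥ r v≤e)

    count<≡0 : ∀ {v r} → All (λ e → v ≤ toℕ e) r → count< v r ≡ 0
    count<≡0 v≤r = cong length (below≡[] v≤r)

    count<-++ : ∀ v xs ys → count< v (xs ++ ys) ≡ count< v xs + count< v ys
    count<-++ v xs ys = trans (cong length (filter-++ _ xs ys)) (length-++ (below v xs))

    count<-++-≥ : ∀ {v} xs {ys} → All (λ e → v ≤ toℕ e) ys → count< v (xs ++ ys) ≡ count< v xs
    count<-++-≥ xs v≤ys = cong length (below-++-≥ xs v≤ys)

    count<-replicate : ∀ {v e} a → toℕ e < v → count< v (replicate a e) ≡ a
    count<-replicate a e<v = trans (cong length (filter-all _ (Allₚ.replicate⁺ a e<v))) (length-replicate a)

    count<≡length : ∀ {v} → n ≤ v → ∀ r → count< v r ≡ length r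
    count<≡length n≤v r = cong length (filter-all _ (All.universal (λ e → <-≤-trans (toℕ<n e) n≤v) r))

    count<-≤-∷ : ∀ v e r → count< v r ≤ count< v (e ∷ r)
    count<-≤-∷ v e r with toℕ e <? v
    ... | yes e<v = ≤-trans (n≤1+n _) (≤-reflexive (sym (count<-∷-< r e<v)))
    ... | no  e≮v = ≤-reflexive (sym (count<-∷-≥ r (≮⇒≥ e≮v)))

    count<-mono : ∀ {v w} → v ≤ w → ∀ r → count< v r ≤ count< w r
    count<-mono v≤w []      = z≤n
    count<-mono {v} {w} v≤w (e ∷ r) with toℕ e <? v
    ... | yes e<v rewrite count<-∷-< r e<v | count<-∷-< r (<-≤-trans e<v v≤w) = s≤s (count<-mono v≤w r)
    ... | no  e≮v rewrite count<-∷-≥ r (≮⇒≥ e≮v) = ≤-trans (count<-mono v≤w r) (count<-≤-∷ w e r)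

    Increasing : Row n → Set
    Increasing = AllPairs Fin._≤_

    replicate-increasing : ∀ a e → Increasing (replicate a e)
    replicate-increasing zero    e = []
    replicate-increasing (suc a) e = Allₚ.replicate⁺ a ≤-refl ∷ replicate-increasing a e

    ++-increasing : ∀ {xs ys} v → Increasing xs → Increasing ys →
                    All (λ e → toℕ e ≤ v) xs → All (λ e → v ≤ toℕ e) ys → Increasing (xs ++ ys)
    ++-increasing v xs↑ ys↑ xs≤v v≤ys =
      AllPairs.++⁺ xs↑ ys↑ (All.map (λ e≤v → All.map (≤-trans e≤v) v≤ys) xs≤v)

    -- Column strictness without positions: the lower row has at most as many entries ≤ v as the
    -- upper row has entries < v.  At v = n this says that the lower row is not longer.
    Stacked : Row n → Row n → Set
    Stacked r s = ∀ v → count< (suc v) s ≤ count< v r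

    top : Tableau n → Row n
    top []      = []
    top (r ∷ _) = r

    data Semistandard : Tableau n → Set where
      []   : Semistandard []
      cons : ∀ {r rs} → Increasing r → Stacked r (top rs) → Semistandard rs → Semistandard (r ∷ rs)

    semistandard⇒increasing : ∀ {t} → Semistandard t → All Increasing t
    semistandard⇒increasing []              = []
    semistandard⇒increasing (cons r↑ _ ss) = r↑ ∷ semistandard⇒increasing ss

    stacked⇒length≤ : ∀ {r s} → Stacked r s → length s ≤ length r
    stacked⇒length≤ {r} {s} st = subst₂ _≤_ (count<≡length (n≤1+n n) s) (count<≡length ≤-refl r) (st n)

    rowWeak⇒increasing : ∀ r → T (rowWeak r) → Increasing r
    rowWeak⇒increasing r = Linked⇒AllPairs ≤-trans ∘ linked r
      where
      linked : ∀ r → T (rowWeak r) → Linked Fin._≤_ r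
      linked []          _ = []
      linked (a ∷ [])    _ = [-]
      linked (a ∷ b ∷ r) p = ≤ᵇ⇒≤ _ _ (proj₁ split) ∷ linked (b ∷ r) (proj₂ split)
        where
        split : T (toℕ a ≤ᵇ toℕ b) × T (rowWeak (b ∷ r))
        split = T-∧⁻ (toℕ a ≤ᵇ toℕ b) p

    increasing⇒rowWeak : ∀ r → Increasing r → T (rowWeak r)
    increasing⇒rowWeak r = rowWeak-linked r ∘ AllPairs⇒Linked
      where
      rowWeak-linked : ∀ r → Linked Fin._≤_ r → T (rowWeak r)
      rowWeak-linked []          _            = _
      rowWeak-linked (a ∷ [])    _            = _
      rowWeak-linked (a ∷ b ∷ r) (a≤b ∷ rest) =
        T-∧⁺ (toℕ a ≤ᵇ toℕ b) (≤⇒≤ᵇ a≤b) (rowWeak-linked (b ∷ r) rest)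

    colStrict⇒stacked : ∀ r s → length s ≤ length r → T (colStrict r s) → Stacked r s
    colStrict⇒stacked r       []      _         _      v = z≤n
    colStrict⇒stacked (a ∷ r) (c ∷ s) (s≤s s≤r) strict v
      with a<c , strict′ ← T-∧⁻ (toℕ a <ᵇ toℕ c) strict | toℕ c <? suc v
    ... | yes c≤v rewrite count<-∷-< s c≤v | count<-∷-< r (<-≤-trans (<ᵇ⇒< _ _ a<c) (≤-pred c≤v)) =
      s≤s (colStrict⇒stacked r s s≤r strict′ v)
    ... | no  c≰v rewrite count<-∷-≥ s (≮⇒≥ c≰v) =
      ≤-trans (colStrict⇒stacked r s s≤r strict′ v) (count<-≤-∷ v a r)

    stacked⇒colStrict : ∀ r s → Increasing r → Increasing s → Stacked r s → T (colStrict r s)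
    stacked⇒colStrict []      s       _            _            _  = _
    stacked⇒colStrict (a ∷ r) []      _            _            _  = _
    stacked⇒colStrict (a ∷ r) (c ∷ s) (a≤r ∷ r↑) (c≤s ∷ s↑) st =
      T-∧⁺ (toℕ a <ᵇ toℕ c) (<⇒<ᵇ a<c) (stacked⇒colStrict r s r↑ s↑ st′)
      where
      a<c : toℕ a < toℕ c
      a<c with toℕ a <? toℕ c
      ... | yes a<c = a<c
      ... | no  a≮c = ⊥-elim (n≮0 (subst₂ _≤_ (count<-∷-< s (n<1+n (toℕ c))) none (st (toℕ c))))
        where
        none : count< (toℕ c) (a ∷ r) ≡ 0
        none = count<≡0 (≮⇒≥ a≮c ∷ All.map (≤-trans (≮⇒≥ a≮c)) a≤r)
      st′ : Stacked r s
      st′ v with toℕ c <? suc v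
      ... | yes c≤v =
        ≤-pred (subst₂ _≤_ (count<-∷-< s c≤v) (count<-∷-< r (<-≤-trans a<c (≤-pred c≤v))) (st v))
      ... | no  c≰v = subst (_≤ _) (sym (count<≡0 (All.map (≤-trans (≮⇒≥ c≰v)) c≤s))) z≤n

    isSSYT⇒semistandard : ∀ t → T (isSSYT t) → Linked _≥_ (map length t) → Semistandard t
    isSSYT⇒semistandard []          _    _             = []
    isSSYT⇒semistandard (r ∷ [])    ssyt _             = cons (rowWeak⇒increasing r ssyt) (λ _ → z≤n) []
    isSSYT⇒semistandard (r ∷ s ∷ t) ssyt (s≤r ∷ shape) =
      cons (rowWeak⇒increasing r rowWeak-r) (colStrict⇒stacked r s s≤r colStrict-rs)
           (isSSYT⇒semistandard (s ∷ t) ssyt-st shape)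
      where
      rowWeak-r : T (rowWeak r)
      rowWeak-r = proj₁ (T-∧⁻ (rowWeak r) ssyt)
      colStrict-rs : T (colStrict r s)
      colStrict-rs = proj₁ (T-∧⁻ (colStrict r s) (proj₂ (T-∧⁻ (rowWeak r) ssyt)))
      ssyt-st : T (isSSYT (s ∷ t))
      ssyt-st = proj₂ (T-∧⁻ (colStrict r s) (proj₂ (T-∧⁻ (rowWeak r) ssyt)))

    semistandard⇒isSSYT : ∀ {t} → Semistandard t → T (isSSYT t)
    semistandard⇒isSSYT []                                             = _
    semistandard⇒isSSYT (cons r↑ _ [])                                 = increasing⇒rowWeak _ r↑
    semistandard⇒isSSYT {r ∷ s ∷ _} (cons r↑ st ss@(cons s↑ _ _)) =
      T-∧⁺ (rowWeak r) (increasing⇒rowWeak r r↑)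
        (T-∧⁺ (colStrict r s) (stacked⇒colStrict r s r↑ s↑ st) (semistandard⇒isSSYT ss))

    semistandard⇒shape : ∀ {t} → Semistandard t → Linked _≥_ (map length t)
    semistandard⇒shape []                                          = []
    semistandard⇒shape (cons _ _ [])                               = [-]
    semistandard⇒shape {r ∷ s ∷ _} (cons _ st ss@(cons _ _ _)) =
      stacked⇒length≤ {r} {s} st ∷ semistandard⇒shape ss

    semistandard? : ∀ t → Dec (Semistandard t)
    semistandard? t = map′ (uncurry (isSSYT⇒semistandard t)) < semistandard⇒isSSYT , semistandard⇒shape >
                           (T? (isSSYT t) ×-dec linked? _≥?_ (map length t))

  module BenderKnuth {n : ℕ} (i i⁺ : Fin n) (i⁺≡ : toℕ i⁺ ≡ suc (toℕ i)) where

    k : ℕ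
    k = toℕ i

    NL N1 N2 : Row n → ℕ
    NL = count< k
    N1 = count< (suc k)
    N2 = count< (suc (suc k))

    high : Row n → Row n
    high = filter (λ e → suc (suc k) ≤? toℕ e)

    resplit : Row n → ℕ → Row n
    resplit r m = below k r ++ replicate (m ∸ NL r) i ++ replicate (N2 r ∸ m) i⁺ ++ high r

    k≤i⁺ : k ≤ toℕ i⁺
    k≤i⁺ = ≤-trans (n≤1+n k) (≤-reflexive (sym i⁺≡))

    k<k+2 : k < suc (suc k)
    k<k+2 = m<n⇒m<1+n (n<1+n k)

    i⁺<k+2 : toℕ i⁺ < suc (suc k)
    i⁺<k+2 = ≤-reflexive (cong suc i⁺≡)

    high-∷-≥ : ∀ {e} r → suc (suc k) ≤ toℕ e → high (e ∷ r) ≡ e ∷ high r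
    high-∷-≥ r = filter-accept (λ e → suc (suc k) ≤? toℕ e) {xs = r}

    high-∷-< : ∀ {e} r → toℕ e < suc (suc k) → high (e ∷ r) ≡ high r
    high-∷-< r e<k+2 = filter-reject (λ e → suc (suc k) ≤? toℕ e) {xs = r} (<⇒≱ e<k+2)

    high-++-< : ∀ {xs} ys → All (λ e → toℕ e < suc (suc k)) xs → high (xs ++ ys) ≡ high ys
    high-++-< {xs} ys xs<k+2 = trans (filter-++ _ xs ys) (cong (_++ high ys) (filter-none _ (All.map <⇒≱ xs<k+2)))

    all-below : ∀ v (r : Row n) → All (λ e → toℕ e < v) (below v r)
    all-below v = Allₚ.all-filter {P = λ e → toℕ e < v} (λ e → toℕ e <? v)

    all-high : ∀ r → All (λ e → suc (suc k) ≤ toℕ e) (high r)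
    all-high = Allₚ.all-filter {P = λ e → suc (suc k) ≤ toℕ e} (λ e → suc (suc k) ≤? toℕ e)

    resplit-tail-≥ : ∀ {v} → v ≤ k → ∀ r a b →
                     All (λ e → v ≤ toℕ e) (replicate a i ++ replicate b i⁺ ++ high r)
    resplit-tail-≥ v≤k r a b =
      Allₚ.++⁺ (Allₚ.replicate⁺ a v≤k)
        (Allₚ.++⁺ (Allₚ.replicate⁺ b (≤-trans v≤k k≤i⁺))
                  (All.map (≤-trans (≤-trans v≤k (<⇒≤ k<k+2))) (all-high r)))

    resplit-∷-lower : ∀ {e} r → toℕ e < k → resplit (e ∷ r) (N1 (e ∷ r)) ≡ e ∷ resplit r (N1 r)
    resplit-∷-lower r e<k
      rewrite below-∷-< r e<k | below-∷-< r (m<n⇒m<1+n e<k) | below-∷-< r (<-trans e<k k<k+2)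
            | high-∷-< r (<-trans e<k k<k+2) = refl

    resplit-∷-i : ∀ r → All (i Fin.≤_) r → resplit (i ∷ r) (N1 (i ∷ r)) ≡ i ∷ resplit r (N1 r)
    resplit-∷-i r i≤r
      rewrite below-∷-≥ r (≤-refl {k}) | below-∷-< r (n<1+n k) | below-∷-< r k<k+2 | high-∷-< r k<k+2
            | below≡[] i≤r = refl

    resplit-∷-i⁺ : ∀ r → All (i⁺ Fin.≤_) r → resplit (i⁺ ∷ r) (N1 (i⁺ ∷ r)) ≡ i⁺ ∷ resplit r (N1 r)
    resplit-∷-i⁺ r i⁺≤r
      rewrite below-∷-≥ r k≤i⁺ | below-∷-≥ r (≤-reflexive (sym i⁺≡)) | below-∷-< r i⁺<k+2
            | high-∷-< r i⁺<k+2
            | below≡[] (All.map (≤-trans k≤i⁺) i⁺≤r)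
            | below≡[] (All.map (≤-trans (≤-reflexive (sym i⁺≡))) i⁺≤r) = refl

    resplit-∷-upper : ∀ {e} r → suc (suc k) ≤ toℕ e → All (e Fin.≤_) r →
                      resplit (e ∷ r) (N1 (e ∷ r)) ≡ e ∷ r
    resplit-∷-upper {e} r k+2≤e e≤r
      rewrite below-∷-≥ r (≤-trans (<⇒≤ k<k+2) k+2≤e) | below-∷-≥ r (≤-trans (n≤1+n (suc k)) k+2≤e)
            | below-∷-≥ r k+2≤e | high-∷-≥ r k+2≤e
            | below≡[] (All.map (≤-trans (≤-trans (<⇒≤ k<k+2) k+2≤e)) e≤r)
            | below≡[] (All.map (≤-trans (≤-trans (n≤1+n (suc k)) k+2≤e)) e≤r)
            | below≡[] (All.map (≤-trans k+2≤e) e≤r)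
      = cong (e ∷_) (filter-all _ (All.map (≤-trans k+2≤e) e≤r))

    resplit-self : ∀ {r} → Increasing r → resplit r (N1 r) ≡ r
    resplit-self {[]}    []        = refl
    resplit-self {e ∷ r} (e≤r ∷ r↑) with <-cmp (toℕ e) k | <-cmp (toℕ e) (suc k)
    ... | tri< e<k _ _   | _              = trans (resplit-∷-lower r e<k) (cong (e ∷_) (resplit-self r↑))
    ... | tri≈ _ e≡k _   | _ rewrite toℕ-injective {i = e} {j = i} e≡k
                                          = trans (resplit-∷-i r e≤r) (cong (i ∷_) (resplit-self r↑))
    ... | tri> _ _ k<e   | tri< e<k+1 _ _ = ⊥-elim (<⇒≱ k<e (≤-pred e<k+1))
    ... | tri> _ _ _     | tri≈ _ e≡k+1 _ rewrite toℕ-injective {i = e} {j = i⁺} (trans e≡k+1 (sym i⁺≡))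
                                          = trans (resplit-∷-i⁺ r e≤r) (cong (i⁺ ∷_) (resplit-self r↑))
    ... | tri> _ _ _     | tri> _ _ k+1<e = resplit-∷-upper r k+1<e e≤r

    NL≤N1 : ∀ r → NL r ≤ N1 r
    NL≤N1 = count<-mono (n≤1+n k)

    N1≤N2 : ∀ r → N1 r ≤ N2 r
    N1≤N2 = count<-mono (n≤1+n (suc k))

    below-resplit : ∀ r m → below k (resplit r m) ≡ below k r
    below-resplit r m =
      trans (below-++-≥ (below k r) (resplit-tail-≥ ≤-refl r (m ∸ NL r) (N2 r ∸ m))) (filter-idem _ r)

    NL-resplit : ∀ r m → NL (resplit r m) ≡ NL r
    NL-resplit r m = cong length (below-resplit r m)

    high-resplit : ∀ r m → high (resplit r m) ≡ high r
    high-resplit r m = begin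
      high (below k r ++ replicate (m ∸ NL r) i ++ replicate (N2 r ∸ m) i⁺ ++ high r)
        ≡⟨ high-++-< _ (All.map (λ e<k → <-trans e<k k<k+2) (all-below k r)) ⟩
      high (replicate (m ∸ NL r) i ++ replicate (N2 r ∸ m) i⁺ ++ high r)
        ≡⟨ high-++-< (replicate (N2 r ∸ m) i⁺ ++ high r) (Allₚ.replicate⁺ (m ∸ NL r) k<k+2) ⟩
      high (replicate (N2 r ∸ m) i⁺ ++ high r)
        ≡⟨ high-++-< (high r) (Allₚ.replicate⁺ (N2 r ∸ m) i⁺<k+2) ⟩
      high (high r)
        ≡⟨ filter-idem _ r ⟩
      high r
        ∎
      where open ≡-Reasoning

    N1-resplit : ∀ r {m} → NL r ≤ m → N1 (resplit r m) ≡ m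
    N1-resplit r {m} NL≤m = begin
      N1 (below k r ++ replicate (m ∸ NL r) i ++ replicate (N2 r ∸ m) i⁺ ++ high r)
        ≡⟨ count<-++ (suc k) (below k r) _ ⟩
      N1 (below k r) + N1 (replicate (m ∸ NL r) i ++ replicate (N2 r ∸ m) i⁺ ++ high r)
        ≡⟨ cong₂ _+_ N1-below (count<-++-≥ (replicate (m ∸ NL r) i) i⁺s-and-high≥k+1) ⟩
      NL r + N1 (replicate (m ∸ NL r) i)
        ≡⟨ cong (NL r +_) (count<-replicate (m ∸ NL r) (n<1+n k)) ⟩
      NL r + (m ∸ NL r)
        ≡⟨ m+[n∸m]≡n NL≤m ⟩
      m ∎
      where
      open ≡-Reasoning
      N1-below : N1 (below k r) ≡ NL r
      N1-below = cong length (filter-all _ (All.map m<n⇒m<1+n (all-below k r)))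
      i⁺s-and-high≥k+1 : All (λ e → suc k ≤ toℕ e) (replicate (N2 r ∸ m) i⁺ ++ high r)
      i⁺s-and-high≥k+1 =
        Allₚ.++⁺ (Allₚ.replicate⁺ _ (≤-reflexive (sym i⁺≡))) (All.map (≤-trans (n≤1+n _)) (all-high r))

    count<-resplit-≤k : ∀ {v} → v ≤ k → ∀ r m → count< v (resplit r m) ≡ count< v (below k r)
    count<-resplit-≤k v≤k r m = count<-++-≥ (below k r) (resplit-tail-≥ v≤k r (m ∸ NL r) (N2 r ∸ m))

    count<-resplit-≥k+2 : ∀ {v} → suc (suc k) ≤ v → ∀ r {m} → NL r ≤ m → m ≤ N2 r →
                          count< v (resplit r m) ≡ count< v (below k r) + ((N2 r ∸ NL r) + count< v (high r))
    count<-resplit-≥k+2 {v} k+2≤v r {m} NL≤m m≤N2 = begin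
      count< v (below k r ++ replicate a i ++ replicate b i⁺ ++ high r)
        ≡⟨ count<-++ v (below k r) _ ⟩
      L + count< v (replicate a i ++ replicate b i⁺ ++ high r)
        ≡⟨ cong (L +_) (count<-++ v (replicate a i) _) ⟩
      L + (count< v (replicate a i) + count< v (replicate b i⁺ ++ high r))
        ≡⟨ cong (λ z → L + (count< v (replicate a i) + z)) (count<-++ v (replicate b i⁺) (high r)) ⟩
      L + (count< v (replicate a i) + (count< v (replicate b i⁺) + H))
        ≡⟨ cong₂ (λ x y → L + (x + (y + H))) (count<-replicate a (<-≤-trans k<k+2 k+2≤v))
                                              (count<-replicate b (<-≤-trans i⁺<k+2 k+2≤v)) ⟩
      L + (a + (b + H))
        ≡⟨ cong (L +_) (+-assoc a b H) ⟨
      L + (a + b + H)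
        ≡⟨ cong (λ z → L + (z + H)) ([m∸n]+[o∸m]≡o∸n NL≤m m≤N2) ⟩
      L + ((N2 r ∸ NL r) + H) ∎
      where
      open ≡-Reasoning
      a b L H : ℕ
      a = m ∸ NL r
      b = N2 r ∸ m
      L = count< v (below k r)
      H = count< v (high r)

    count<-resplit : ∀ {r m v} → Increasing r → NL r ≤ m → m ≤ N2 r → v ≢ suc k →
                     count< v (resplit r m) ≡ count< v r
    count<-resplit {r} {m} {v} r↑ NL≤m m≤N2 v≢k+1 with ≢-suc⇒≤⊎≥ v≢k+1
    ... | inj₁ v≤k = begin
      count< v (resplit r m)      ≡⟨ count<-resplit-≤k v≤k r m ⟩
      count< v (below k r)        ≡⟨ count<-resplit-≤k v≤k r (N1 r) ⟨
      count< v (resplit r (N1 r)) ≡⟨ cong (count< v) (resplit-self r↑) ⟩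
      count< v r                  ∎
      where open ≡-Reasoning
    ... | inj₂ k+2≤v = begin
      count< v (resplit r m)
        ≡⟨ count<-resplit-≥k+2 k+2≤v r NL≤m m≤N2 ⟩
      count< v (below k r) + ((N2 r ∸ NL r) + count< v (high r))
        ≡⟨ count<-resplit-≥k+2 k+2≤v r (NL≤N1 r) (N1≤N2 r) ⟨
      count< v (resplit r (N1 r))
        ≡⟨ cong (count< v) (resplit-self r↑) ⟩
      count< v r
        ∎
      where open ≡-Reasoning

    N2-resplit : ∀ {r m} → Increasing r → NL r ≤ m → m ≤ N2 r → N2 (resplit r m) ≡ N2 r
    N2-resplit r↑ NL≤m m≤N2 = count<-resplit r↑ NL≤m m≤N2 1+n≢n

    length-resplit : ∀ {r m} → Increasing r → NL r ≤ m → m ≤ N2 r → length (resplit r m) ≡ length r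
    length-resplit {r} {m} r↑ NL≤m m≤N2 =
      subst₂ _≡_ (count<≡length ≤-refl (resplit r m)) (count<≡length ≤-refl r)
                 (count<-resplit r↑ NL≤m m≤N2 n≢k+1)
      where
      n≢k+1 : n ≢ suc k
      n≢k+1 n≡k+1 = <-irrefl (sym n≡k+1) (subst (_< n) i⁺≡ (toℕ<n i⁺))

    resplit-resplit : ∀ {r m} m′ → Increasing r → NL r ≤ m → m ≤ N2 r →
                      resplit (resplit r m) m′ ≡ resplit r m′
    resplit-resplit {r} {m} m′ r↑ NL≤m m≤N2
      rewrite below-resplit r m | high-resplit r m | N2-resplit r↑ NL≤m m≤N2 = refl

    resplit-increasing : ∀ {r} m → Increasing r → Increasing (resplit r m)
    resplit-increasing {r} m r↑ =
      ++-increasing k (AllPairs.filter⁺ _ r↑)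
        (++-increasing (suc k) (replicate-increasing a i)
          (++-increasing (suc k) (replicate-increasing b i⁺) (AllPairs.filter⁺ _ r↑)
            (Allₚ.replicate⁺ b (≤-reflexive i⁺≡)) (All.map (≤-trans (n≤1+n _)) (all-high r)))
          (Allₚ.replicate⁺ a (n≤1+n k))
          (Allₚ.++⁺ (Allₚ.replicate⁺ b (≤-reflexive (sym i⁺≡))) (All.map (≤-trans (n≤1+n _)) (all-high r))))
        (All.map <⇒≤ (all-below k r)) (resplit-tail-≥ ≤-refl r a b)
      where
      a b : ℕ
      a = m ∸ NL r
      b = N2 r ∸ m

    product-map-resplit : ∀ (y : Fin n → ℕ) r m → product (map y (resplit r m)) ≡
      product (map y (below k r)) * (y i ^ (m ∸ NL r) * (y i⁺ ^ (N2 r ∸ m) * product (map y (high r))))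
    product-map-resplit y r m
      rewrite product-map-++ y (below k r) (replicate (m ∸ NL r) i ++ replicate (N2 r ∸ m) i⁺ ++ high r)
            | product-map-++ y (replicate (m ∸ NL r) i) (replicate (N2 r ∸ m) i⁺ ++ high r)
            | product-map-++ y (replicate (N2 r ∸ m) i⁺) (high r)
            | product-map-replicate y (m ∸ NL r) i
            | product-map-replicate y (N2 r ∸ m) i⁺ = refl

    τ : Fin n → Fin n
    τ = transpose i i⁺

    τ-i : τ i ≡ i⁺
    τ-i rewrite dec-true (i Fin.≟ i) refl = refl

    τ-i⁺ : τ i⁺ ≡ i
    τ-i⁺ rewrite dec-false (i⁺ Fin.≟ i) (1+n≢n ∘ trans (sym i⁺≡) ∘ cong toℕ)
               | dec-true (i⁺ Fin.≟ i⁺) refl = refl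

    τ-fix : ∀ {e} → toℕ e ≢ k → toℕ e ≢ suc k → τ e ≡ e
    τ-fix {e} e≢k e≢k+1
      rewrite dec-false (e Fin.≟ i) (e≢k ∘ cong toℕ)
            | dec-false (e Fin.≟ i⁺) (e≢k+1 ∘ flip trans i⁺≡ ∘ cong toℕ) = refl

    product-map-τ : ∀ (y : Fin n → ℕ) {xs} → All (λ e → toℕ e ≢ k × toℕ e ≢ suc k) xs →
                    product (map (y ∘ τ) xs) ≡ product (map y xs)
    product-map-τ y fixed =
      cong product (map-cong-local (All.map (λ (≢k , ≢k+1) → cong y (τ-fix ≢k ≢k+1)) fixed))

    weightOutside : (Fin n → ℕ) → Tableau n → ℕ
    weightOutside y []      = 1
    weightOutside y (r ∷ t) = product (map y (below k r)) * product (map y (high r)) * weightOutside y t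

    weightOutside-τ : ∀ y t → weightOutside (y ∘ τ) t ≡ weightOutside y t
    weightOutside-τ y []      = refl
    weightOutside-τ y (r ∷ t) = cong₂ _*_
      (cong₂ _*_ (product-map-τ y (All.map (λ e<k → <⇒≢ e<k , <⇒≢ (m<n⇒m<1+n e<k)) (all-below k r)))
                 (product-map-τ y (All.map (λ k+2≤e → >⇒≢ (<-≤-trans k<k+2 k+2≤e) , >⇒≢ k+2≤e) (all-high r))))
      (weightOutside-τ y t)

    #i #i⁺ : Tableau n → ℕ
    #i  t = sum (map (λ r → N1 r ∸ NL r) t)
    #i⁺ t = sum (map (λ r → N2 r ∸ N1 r) t)

    weight-split : ∀ y {t} → All Increasing t → weight y t ≡ weightOutside y t * (y i ^ #i t * y i⁺ ^ #i⁺ t)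
    weight-split y {[]}    []         = refl
    weight-split y {r ∷ t} (r↑ ∷ t↑) = begin
      weight y (r ∷ t)
        ≡⟨ weight-∷ y r t ⟩
      product (map y r) * weight y t
        ≡⟨ cong₂ _*_ (cong (product ∘ map y) (sym (resplit-self r↑))) (weight-split y t↑) ⟩
      product (map y (resplit r (N1 r))) * (Q * (I ^ A * J ^ B))
        ≡⟨ cong (_* (Q * (I ^ A * J ^ B))) (product-map-resplit y r (N1 r)) ⟩
      L * (I ^ a * (J ^ b * H)) * (Q * (I ^ A * J ^ B))
        ≡⟨ solve 7 (λ L Ia Jb H Q IA JB → L :* (Ia :* (Jb :* H)) :* (Q :* (IA :* JB))
                                     := L :* H :* Q :* ((Ia :* IA) :* (Jb :* JB)))
                 refl L (I ^ a) (J ^ b) H Q (I ^ A) (J ^ B) ⟩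
      L * H * Q * ((I ^ a * I ^ A) * (J ^ b * J ^ B))
        ≡⟨ cong₂ (λ u v → L * H * Q * (u * v)) (^-distribˡ-+-* I a A) (^-distribˡ-+-* J b B) ⟨
      L * H * Q * (I ^ (a + A) * J ^ (b + B))
        ∎
      where
      open ≡-Reasoning
      I J L H Q a b A B : ℕ
      I = y i
      J = y i⁺
      L = product (map y (below k r))
      H = product (map y (high r))
      Q = weightOutside y t
      a = N1 r ∸ NL r
      b = N2 r ∸ N1 r
      A = #i t
      B = #i⁺ t

    -- In a semistandard tableau, Stacked bounds the number N1 r of entries ≤ i of a row r below by
    -- NL r and by N2 of the row underneath, and above by N2 r and by the ceiling h = NL of the row
    -- above (h = N2 r for the top row).  Rebuilding r with N1 reflected inside these bounds is the
    -- Bender–Knuth move.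
    flipped : ℕ → Row n → Tableau n → ℕ
    flipped h r rs = reflect (NL r ⊔ N2 (top rs)) (N2 r ⊓ h) (N1 r)

    bkRows : ℕ → Tableau n → Tableau n
    bkRows h []       = []
    bkRows h (r ∷ rs) = resplit r (flipped h r rs) ∷ bkRows (NL r) rs

    bk : Tableau n → Tableau n
    bk t = bkRows (N2 (top t)) t

    module Flip (h : ℕ) (r : Row n) (rs : Tableau n)
                (r↑ : Increasing r) (st : Stacked r (top rs)) (N1≤h : N1 r ≤ h) where

      m : ℕ
      m = flipped h r rs

      lo≤N1 : NL r ⊔ N2 (top rs) ≤ N1 r
      lo≤N1 = ⊔-lub (NL≤N1 r) (st (suc k))

      N1≤hi : N1 r ≤ N2 r ⊓ h
      N1≤hi = ⊓-glb (N1≤N2 r) N1≤h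

      lo≤m : NL r ⊔ N2 (top rs) ≤ m
      lo≤m = lo≤reflect lo≤N1 N1≤hi

      m≤hi : m ≤ N2 r ⊓ h
      m≤hi = reflect≤hi lo≤N1 N1≤hi

      NL≤m : NL r ≤ m
      NL≤m = ≤-trans (m≤m⊔n _ _) lo≤m

      m≤N2 : m ≤ N2 r
      m≤N2 = ≤-trans m≤hi (m⊓n≤m _ _)

      NL′ : NL (resplit r m) ≡ NL r
      NL′ = NL-resplit r m

      N1′ : N1 (resplit r m) ≡ m
      N1′ = N1-resplit r NL≤m

      N2′ : N2 (resplit r m) ≡ N2 r
      N2′ = N2-resplit r↑ NL≤m m≤N2

    count<-top-bkRows : ∀ {h t v} → Semistandard t → N1 (top t) ≤ h → v ≢ suc k →
                        count< v (top (bkRows h t)) ≡ count< v (top t)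
    count<-top-bkRows                []             _    _     = refl
    count<-top-bkRows {h} {r ∷ rs} (cons r↑ st _) N1≤h v≢k+1 = count<-resplit r↑ NL≤m m≤N2 v≢k+1
      where open Flip h r rs r↑ st N1≤h

    N1-top-bkRows : ∀ {h t} → Semistandard t → N1 (top t) ≤ h → N1 (top (bkRows h t)) ≤ h
    N1-top-bkRows                []             _    = z≤n
    N1-top-bkRows {h} {r ∷ rs} (cons r↑ st _) N1≤h = subst (_≤ h) (sym N1′) (≤-trans m≤hi (m⊓n≤n _ _))
      where open Flip h r rs r↑ st N1≤h

    bkRows-semistandard : ∀ {h t} → Semistandard t → N1 (top t) ≤ h → Semistandard (bkRows h t)
    bkRows-semistandard                []              _    = []
    bkRows-semistandard {h} {r ∷ rs} (cons r↑ st ss) N1≤h =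
      cons (resplit-increasing m r↑) stacked (bkRows-semistandard ss (st k))
      where
      open Flip h r rs r↑ st N1≤h
      open ≤-Reasoning
      stacked : Stacked (resplit r m) (top (bkRows (NL r) rs))
      stacked v with v ≟ k | v ≟ suc k
      ... | yes refl | _        = begin
        N1 (top (bkRows (NL r) rs)) ≤⟨ N1-top-bkRows ss (st k) ⟩
        NL r                        ≡⟨ NL′ ⟨
        NL (resplit r m)            ∎
      ... | no _     | yes refl = begin
        N2 (top (bkRows (NL r) rs)) ≡⟨ count<-top-bkRows ss (st k) 1+n≢n ⟩
        N2 (top rs)                 ≤⟨ ≤-trans (m≤n⊔m _ _) lo≤m ⟩
        m                           ≡⟨ N1′ ⟨
        N1 (resplit r m)            ∎
      ... | no v≢k   | no v≢k+1 = begin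
        count< (suc v) (top (bkRows (NL r) rs)) ≡⟨ count<-top-bkRows ss (st k) (v≢k ∘ suc-injective) ⟩
        count< (suc v) (top rs)                 ≤⟨ st v ⟩
        count< v r                              ≡⟨ count<-resplit r↑ NL≤m m≤N2 v≢k+1 ⟨
        count< v (resplit r m)                  ∎

    bkRows-involutive : ∀ {h t} → Semistandard t → N1 (top t) ≤ h → bkRows h (bkRows h t) ≡ t
    bkRows-involutive                []              _    = refl
    bkRows-involutive {h} {r ∷ rs} (cons r↑ st ss) N1≤h = cong₂ _∷_ row-restored rows-restored
      where
      open Flip h r rs r↑ st N1≤h
      open ≡-Reasoning
      flipped-back : flipped h (resplit r m) (bkRows (NL r) rs) ≡ N1 r
      flipped-back rewrite NL′ | N2′ | N1′ | count<-top-bkRows {v = suc (suc k)} ss (st k) 1+n≢n =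
        reflect-involutive lo≤N1 N1≤hi
      row-restored : resplit (resplit r m) (flipped h (resplit r m) (bkRows (NL r) rs)) ≡ r
      row-restored = begin
        resplit (resplit r m) (flipped h (resplit r m) (bkRows (NL r) rs))
          ≡⟨ cong (resplit (resplit r m)) flipped-back ⟩
        resplit (resplit r m) (N1 r)
          ≡⟨ resplit-resplit (N1 r) r↑ NL≤m m≤N2 ⟩
        resplit r (N1 r)
          ≡⟨ resplit-self r↑ ⟩
        r
          ∎
      rows-restored : bkRows (NL (resplit r m)) (bkRows (NL r) rs) ≡ rs
      rows-restored rewrite NL′ = bkRows-involutive ss (st k)

    map-length-bkRows : ∀ {h t} → Semistandard t → N1 (top t) ≤ h → map length (bkRows h t) ≡ map length t
    map-length-bkRows                []              _    = refl
    map-length-bkRows {h} {r ∷ rs} (cons r↑ st ss) N1≤h =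
      cong₂ _∷_ (length-resplit r↑ NL≤m m≤N2) (map-length-bkRows ss (st k))
      where open Flip h r rs r↑ st N1≤h

    weightOutside-bkRows : ∀ y h t → weightOutside y (bkRows h t) ≡ weightOutside y t
    weightOutside-bkRows y h []       = refl
    weightOutside-bkRows y h (r ∷ rs) rewrite below-resplit r (flipped h r rs) | high-resplit r (flipped h r rs) =
      cong (product (map y (below k r)) * product (map y (high r)) *_) (weightOutside-bkRows y (NL r) rs)

    -- With h = N2 (top t) this says #i (bk t) ≡ #i⁺ t.
    #i-bkRows : ∀ {h t} → Semistandard t → N1 (top t) ≤ h →
                #i (bkRows h t) + N2 (top t) ≡ #i⁺ t + N2 (top t) ⊓ h
    #i-bkRows                []              _    = refl
    #i-bkRows {h} {r ∷ rs} (cons r↑ st ss) N1≤h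
      rewrite Flip.N1′ h r rs r↑ st N1≤h | Flip.NL′ h r rs r↑ st N1≤h =
      telescope-step {X = #i (bkRows (NL r) rs)} {Y = #i⁺ rs} {a = NL r} {b = N1 r} {c = N2 r} {d = N2 (top rs)}
        (m∸n+n≡m NL≤m) (m∸n+n≡m (N1≤N2 r)) (reflect+m≡lo+hi lo≤N1 N1≤hi)
        (m⊔n+n⊓m≡m+n (NL r) (N2 (top rs))) (#i-bkRows ss (st k))
      where open Flip h r rs r↑ st N1≤h

    #i+#i⁺-bkRows : ∀ {h t} → Semistandard t → N1 (top t) ≤ h →
                    #i (bkRows h t) + #i⁺ (bkRows h t) ≡ #i t + #i⁺ t
    #i+#i⁺-bkRows                []              _    = refl
    #i+#i⁺-bkRows {h} {r ∷ rs} (cons r↑ st ss) N1≤h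
      rewrite Flip.N1′ h r rs r↑ st N1≤h | Flip.NL′ h r rs r↑ st N1≤h | Flip.N2′ h r rs r↑ st N1≤h = begin
      (m ∸ NL r + #i rs′) + (N2 r ∸ m + #i⁺ rs′)
        ≡⟨ interchange (m ∸ NL r) (#i rs′) (N2 r ∸ m) (#i⁺ rs′) ⟩
      (m ∸ NL r + (N2 r ∸ m)) + (#i rs′ + #i⁺ rs′)
        ≡⟨ cong₂ _+_ ([m∸n]+[o∸m]≡o∸n NL≤m m≤N2) (#i+#i⁺-bkRows ss (st k)) ⟩
      (N2 r ∸ NL r) + (#i rs + #i⁺ rs)
        ≡⟨ cong (_+ (#i rs + #i⁺ rs)) ([m∸n]+[o∸m]≡o∸n (NL≤N1 r) (N1≤N2 r)) ⟨
      (N1 r ∸ NL r + (N2 r ∸ N1 r)) + (#i rs + #i⁺ rs)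
        ≡⟨ interchange (N1 r ∸ NL r) (N2 r ∸ N1 r) (#i rs) (#i⁺ rs) ⟩
      (N1 r ∸ NL r + #i rs) + (N2 r ∸ N1 r + #i⁺ rs)
        ∎
      where
      open Flip h r rs r↑ st N1≤h
      open ≡-Reasoning
      rs′ : Tableau n
      rs′ = bkRows (NL r) rs

    bk-semistandard : ∀ {t} → Semistandard t → Semistandard (bk t)
    bk-semistandard {t} ss = bkRows-semistandard ss (N1≤N2 (top t))

    bk-involutive : ∀ {t} → Semistandard t → bk (bk t) ≡ t
    bk-involutive {t} ss = begin
      bkRows (N2 (top (bk t))) (bk t)
        ≡⟨ cong (λ h → bkRows h (bk t)) (count<-top-bkRows ss (N1≤N2 (top t)) 1+n≢n) ⟩
      bkRows (N2 (top t)) (bk t)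
        ≡⟨ bkRows-involutive ss (N1≤N2 (top t)) ⟩
      t
        ∎
      where open ≡-Reasoning

    #i-bk : ∀ {t} → Semistandard t → #i (bk t) ≡ #i⁺ t
    #i-bk {t} ss = +-cancelʳ-≡ (N2 (top t)) _ _
      (trans (#i-bkRows ss (N1≤N2 (top t))) (cong (#i⁺ t +_) (⊓-idem (N2 (top t)))))

    #i⁺-bk : ∀ {t} → Semistandard t → #i⁺ (bk t) ≡ #i t
    #i⁺-bk {t} ss = +-cancelˡ-≡ (#i⁺ t) _ _ (begin
      #i⁺ t + #i⁺ (bk t)     ≡⟨ cong (_+ #i⁺ (bk t)) (#i-bk ss) ⟨
      #i (bk t) + #i⁺ (bk t) ≡⟨ #i+#i⁺-bkRows ss (N1≤N2 (top t)) ⟩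
      #i t + #i⁺ t           ≡⟨ +-comm (#i t) (#i⁺ t) ⟩
      #i⁺ t + #i t           ∎)
      where open ≡-Reasoning

    weight-bk : ∀ y {t} → Semistandard t → weight y (bk t) ≡ weight (y ∘ τ) t
    weight-bk y {t} ss = begin
      weight y (bk t)
        ≡⟨ weight-split y (semistandard⇒increasing (bk-semistandard ss)) ⟩
      weightOutside y (bk t) * (y i ^ #i (bk t) * y i⁺ ^ #i⁺ (bk t))
        ≡⟨ cong₂ (λ u v → weightOutside y (bk t) * (y i ^ u * y i⁺ ^ v)) (#i-bk ss) (#i⁺-bk ss) ⟩
      weightOutside y (bk t) * (y i ^ #i⁺ t * y i⁺ ^ #i t)
        ≡⟨ cong₂ _*_ (trans (weightOutside-bkRows y _ t) (sym (weightOutside-τ y t)))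
                     (*-comm (y i ^ #i⁺ t) (y i⁺ ^ #i t)) ⟩
      weightOutside (y ∘ τ) t * (y i⁺ ^ #i t * y i ^ #i⁺ t)
        ≡⟨ cong₂ (λ u v → weightOutside (y ∘ τ) t * (y u ^ #i t * y v ^ #i⁺ t)) τ-i τ-i⁺ ⟨
      weightOutside (y ∘ τ) t * (y (τ i) ^ #i t * y (τ i⁺) ^ #i⁺ t)
        ≡⟨ weight-split (y ∘ τ) (semistandard⇒increasing ss) ⟨
      weight (y ∘ τ) t
        ∎
      where open ≡-Reasoning

    bkIfSemistandard : Tableau n → Tableau n
    bkIfSemistandard t with semistandard? t
    ... | yes _ = bk t
    ... | no  _ = t

    bkIfSemistandard-yes : ∀ {t} → Semistandard t → bkIfSemistandard t ≡ bk t
    bkIfSemistandard-yes {t} ss with semistandard? t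
    ... | yes _   = refl
    ... | no  ¬ss = ⊥-elim (¬ss ss)

    bkIfSemistandard-no : ∀ {t} → ¬ Semistandard t → bkIfSemistandard t ≡ t
    bkIfSemistandard-no {t} ¬ss with semistandard? t
    ... | yes ss = ⊥-elim (¬ss ss)
    ... | no  _  = refl

    bkIfSemistandard-involutive : ∀ t → bkIfSemistandard (bkIfSemistandard t) ≡ t
    bkIfSemistandard-involutive t with semistandard? t
    ... | yes ss = begin
      bkIfSemistandard (bk t) ≡⟨ bkIfSemistandard-yes (bk-semistandard ss) ⟩
      bk (bk t)               ≡⟨ bk-involutive ss ⟩
      t                       ∎
      where open ≡-Reasoning
    ... | no  ¬ss = bkIfSemistandard-no ¬ss

    map-length-bkIfSemistandard : ∀ t → map length (bkIfSemistandard t) ≡ map length t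
    map-length-bkIfSemistandard t with semistandard? t
    ... | yes ss = map-length-bkRows ss (N1≤N2 (top t))
    ... | no  _  = refl

    ssytWeight-bkIfSemistandard : ∀ y {t} → Linked _≥_ (map length t) →
                                  ssytWeight y (bkIfSemistandard t) ≡ ssytWeight (y ∘ τ) t
    ssytWeight-bkIfSemistandard y {t} shape with semistandard? t
    ... | yes ss = begin
      ssytWeight y (bk t)  ≡⟨ ssytWeight-ssyt y (bk t) (semistandard⇒isSSYT (bk-semistandard ss)) ⟩
      weight y (bk t)      ≡⟨ weight-bk y ss ⟩
      weight (y ∘ τ) t     ≡⟨ ssytWeight-ssyt (y ∘ τ) t (semistandard⇒isSSYT ss) ⟨
      ssytWeight (y ∘ τ) t ∎
      where open ≡-Reasoning
    ... | no ¬ss = trans (ssytWeight-¬ssyt y t ¬ssyt) (sym (ssytWeight-¬ssyt (y ∘ τ) t ¬ssyt))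
      where
      ¬ssyt : ¬ T (isSSYT t)
      ¬ssyt ssyt = ¬ss (isSSYT⇒semistandard t ssyt shape)

    schur-τ : ∀ μ → Linked _≥_ μ → ∀ y → schur n μ (y ∘ τ) ≡ schur n μ y
    schur-τ μ μ↓ y = begin
      schur n μ (y ∘ τ)
        ≡⟨ schur≡sum-ssytWeight n μ (y ∘ τ) ⟩
      sum (map (ssytWeight (y ∘ τ)) (fillings n μ))
        ≡⟨ cong sum (map-cong-local (All.tabulate (λ t∈ → ssytWeight-bkIfSemistandard y (shape t∈)))) ⟨
      sum (map (ssytWeight y ∘ bkIfSemistandard) (fillings n μ))
        ≡⟨ sum-map-involution bkIfSemistandard (ssytWeight y) (fillings-unique μ)
                              bkIfSemistandard-involutive closed ⟩
      sum (map (ssytWeight y) (fillings n μ))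
        ≡⟨ schur≡sum-ssytWeight n μ y ⟨
      schur n μ y
        ∎
      where
      open ≡-Reasoning
      shape : ∀ {t} → t ∈ fillings n μ → Linked _≥_ (map length t)
      shape t∈ = subst (Linked _≥_) (sym (∈-fillings⁻ μ t∈)) μ↓
      closed : ∀ {t} → t ∈ fillings n μ → bkIfSemistandard t ∈ fillings n μ
      closed {t} t∈ = subst (λ ν → bkIfSemistandard t ∈ fillings n ν)
        (trans (map-length-bkIfSemistandard t) (∈-fillings⁻ μ t∈)) (∈-fillings⁺ (bkIfSemistandard t))

  SchurEquivalent : ∀ {n} → (Fin n → ℕ) → (Fin n → ℕ) → Set
  SchurEquivalent {n} x y = ∀ μ → Linked _≥_ μ → schur n μ x ≡ schur n μ y

  record Moved {n} (x : Fin n → ℕ) (p t : Fin n) : Set where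
    field
      y           : Fin n → ℕ
      equivalent  : SchurEquivalent x y
      arrives     : y t ≡ x p
      fixes-below : ∀ j → toℕ j < toℕ p → y j ≡ x j
      fixes-above : ∀ j → toℕ t < toℕ j → y j ≡ x j

  move : ∀ {n} d (x : Fin n → ℕ) p t → toℕ t ≡ d + toℕ p → Moved x p t
  move zero x p t t≡p = record
    { y           = x
    ; equivalent  = λ _ _ → refl
    ; arrives     = cong x (toℕ-injective t≡p)
    ; fixes-below = λ _ _ → refl
    ; fixes-above = λ _ _ → refl
    }
  move {n} (suc d) x p t t≡ = record
    { y           = y
    ; equivalent  = λ μ μ↓ → trans (sym (schur-τ μ μ↓ x)) (equivalent μ μ↓)
    ; arrives     = trans arrives (cong x τ-i⁺)
    ; fixes-below = λ j j<p → let j<p⁺ = <-≤-trans (m<n⇒m<1+n j<p) (≤-reflexive (sym p⁺≡)) in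
                    trans (fixes-below j j<p⁺) (cong x (τ-fix (<⇒≢ j<p) (<⇒≢ (m<n⇒m<1+n j<p))))
    ; fixes-above = λ j t<j → trans (fixes-above j t<j)
                                    (cong x (τ-fix (>⇒≢ (<-trans p<t t<j)) (>⇒≢ (≤-<-trans p<t t<j))))
    }
    where
    p<t : toℕ p < toℕ t
    p<t = ≤-trans (s≤s (m≤n+m (toℕ p) d)) (≤-reflexive (sym t≡))
    p⁺ : Fin n
    p⁺ = Fin.fromℕ< (≤-<-trans p<t (toℕ<n t))
    p⁺≡ : toℕ p⁺ ≡ suc (toℕ p)
    p⁺≡ = toℕ-fromℕ< _
    open BenderKnuth p p⁺ p⁺≡ using (τ; schur-τ; τ-i⁺; τ-fix)
    open Moved (move d (x ∘ τ) p⁺ t (trans t≡ (trans (sym (+-suc d (toℕ p))) (cong (d +_) (sym p⁺≡)))))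

  rowWeak-++ : ∀ {n} (r : Row n) v → T (rowWeak r) → All (λ e → toℕ e ≤ toℕ v) r →
               T (rowWeak (r ++ v ∷ []))
  rowWeak-++ []          v _ _          = _
  rowWeak-++ (a ∷ [])    v _ (a≤v ∷ []) = T-∧⁺ (toℕ a ≤ᵇ toℕ v) (≤⇒≤ᵇ a≤v) _
  rowWeak-++ (a ∷ b ∷ r) v p (_ ∷ b≤v)  =
    T-∧⁺ (toℕ a ≤ᵇ toℕ b) (proj₁ split) (rowWeak-++ (b ∷ r) v (proj₂ split) b≤v)
    where
    split : T (toℕ a ≤ᵇ toℕ b) × T (rowWeak (b ∷ r))
    split = T-∧⁻ (toℕ a ≤ᵇ toℕ b) p

  colStrict-++ : ∀ {n} (r s : Row n) v → length s ≤ length r → colStrict (r ++ v ∷ []) s ≡ colStrict r s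
  colStrict-++ []      []      v _         = refl
  colStrict-++ (a ∷ r) []      v _         = refl
  colStrict-++ (a ∷ r) (c ∷ s) v (s≤s s≤r) = cong ((toℕ a <ᵇ toℕ c) ∧_) (colStrict-++ r s v s≤r)

  colStrict⇒≤penultimate : ∀ {m} (r s : Row (2 + m)) → length r ≤ length s → T (colStrict r s) →
                           All (λ e → toℕ e ≤ m) r
  colStrict⇒≤penultimate []      _       _         _      = []
  colStrict⇒≤penultimate (a ∷ r) (c ∷ s) (s≤s r≤s) strict =
    ≤-pred (≤-trans (<ᵇ⇒< _ _ (proj₁ split)) (≤-pred (toℕ<n c)))
      ∷ colStrict⇒≤penultimate r s r≤s (proj₂ split)
    where
    split : T (toℕ a <ᵇ toℕ c) × T (colStrict r s)
    split = T-∧⁻ (toℕ a <ᵇ toℕ c) strict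

  weight-++ : ∀ {n} (x : Fin n → ℕ) r v t → weight x ((r ++ v ∷ []) ∷ t) ≡ weight x (r ∷ t) * x v
  weight-++ x r v t = begin
    weight x ((r ++ v ∷ []) ∷ t)               ≡⟨ weight-∷ x (r ++ v ∷ []) t ⟩
    product (map x (r ++ v ∷ [])) * weight x t ≡⟨ cong (_* weight x t) (product-map-++ x r (v ∷ [])) ⟩
    product (map x r) * (x v * 1) * weight x t ≡⟨ solve 3 (λ R X W → R :* (X :* con 1) :* W := R :* W :* X)
                                                          refl (product (map x r)) (x v) (weight x t) ⟩
    product (map x r) * weight x t * x v       ≡⟨ cong (_* x v) (weight-∷ x r t) ⟨
    weight x (r ∷ t) * x v                     ∎
    where open ≡-Reasoning

  module _ {m : ℕ} where

    penultimate ultimate : Fin (2 + m)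
    penultimate = Fin.inject₁ (Fin.fromℕ m)
    ultimate    = Fin.fromℕ (suc m)

    toℕ-penultimate : toℕ penultimate ≡ m
    toℕ-penultimate = trans (toℕ-inject₁ (Fin.fromℕ m)) (toℕ-fromℕ m)

    penultimate<ultimate : toℕ penultimate < toℕ ultimate
    penultimate<ultimate = subst₂ _<_ (sym toℕ-penultimate) (sym (toℕ-fromℕ (suc m))) (n<1+n m)

    ssytWeight-++ : ∀ (x : Fin (2 + m) → ℕ) r s t v → length r ≡ length s → m ≤ toℕ v →
                    ssytWeight x (r ∷ s ∷ t) * x v ≤ ssytWeight x ((r ++ v ∷ []) ∷ s ∷ t)
    ssytWeight-++ x r s t v r≡s m≤v with T? (isSSYT (r ∷ s ∷ t))
    ... | no ¬ssyt rewrite ssytWeight-¬ssyt x (r ∷ s ∷ t) ¬ssyt = z≤n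
    ... | yes ssyt = ≤-reflexive (begin
      ssytWeight x (r ∷ s ∷ t) * x v       ≡⟨ cong (_* x v) (ssytWeight-ssyt x (r ∷ s ∷ t) ssyt) ⟩
      weight x (r ∷ s ∷ t) * x v           ≡⟨ weight-++ x r v (s ∷ t) ⟨
      weight x ((r ++ v ∷ []) ∷ s ∷ t)     ≡⟨ ssytWeight-ssyt x ((r ++ v ∷ []) ∷ s ∷ t) ssyt′ ⟨
      ssytWeight x ((r ++ v ∷ []) ∷ s ∷ t) ∎)
      where
      open ≡-Reasoning
      rowWeak-r : T (rowWeak r)
      rowWeak-r = proj₁ (T-∧⁻ (rowWeak r) ssyt)
      rest : T (colStrict r s ∧ isSSYT (s ∷ t))
      rest = proj₂ (T-∧⁻ (rowWeak r) ssyt)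
      r≤v : All (λ e → toℕ e ≤ toℕ v) r
      r≤v = All.map (λ e≤m → ≤-trans e≤m m≤v)
                    (colStrict⇒≤penultimate r s (≤-reflexive r≡s) (proj₁ (T-∧⁻ (colStrict r s) rest)))
      ssyt′ : T (isSSYT ((r ++ v ∷ []) ∷ s ∷ t))
      ssyt′ = T-∧⁺ (rowWeak (r ++ v ∷ [])) (rowWeak-++ r v rowWeak-r r≤v)
                   (subst (λ b → T (b ∧ isSSYT (s ∷ t))) (sym (colStrict-++ r s v (≤-reflexive (sym r≡s))))
                          rest)

    schur-append-last-two : ∀ a μ (x : Fin (2 + m) → ℕ) →
      schur (2 + m) (a ∷ a ∷ μ) x * (x penultimate + x ultimate) ≤ schur (2 + m) (suc a ∷ a ∷ μ) x
    schur-append-last-two a μ x = begin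
      schur (2 + m) (a ∷ a ∷ μ) x * (x penultimate + x ultimate)
        ≡⟨ cong (_* (x penultimate + x ultimate)) (schur-by-first-row a) ⟩
      sum (map G (words (2 + m) a)) * (x penultimate + x ultimate)
        ≡⟨ sum-map-*ʳ G _ (words (2 + m) a) ⟩
      sum (map (λ r → G r * (x penultimate + x ultimate)) (words (2 + m) a))
        ≤⟨ sum-map-mono (All.tabulate G-append-last-two) ⟩
      sum (map (λ r → sum (map (λ v → G (r ++ v ∷ [])) (allFin (2 + m)))) (words (2 + m) a))
        ≡⟨ sum-words-suc a G ⟨
      sum (map G (words (2 + m) (suc a)))
        ≡⟨ schur-by-first-row (suc a) ⟨
      schur (2 + m) (suc a ∷ a ∷ μ) x
        ∎
      where
      open ≤-Reasoning
      G : Row (2 + m) → ℕ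
      G r = sum (map (λ t → ssytWeight x (r ∷ t)) (fillings (2 + m) (a ∷ μ)))
      schur-by-first-row : ∀ a′ → schur (2 + m) (a′ ∷ a ∷ μ) x ≡ sum (map G (words (2 + m) a′))
      schur-by-first-row a′ = trans (schur≡sum-ssytWeight (2 + m) (a′ ∷ a ∷ μ) x)
        (trans (cong (sum ∘ map (ssytWeight x)) (fillings-∷ a′ (a ∷ μ)))
               (sum-map-cartesianProductWith _∷_ (ssytWeight x) (words (2 + m) a′) (fillings (2 + m) (a ∷ μ))))
      G-append : ∀ {r} → r ∈ words (2 + m) a → ∀ v → m ≤ toℕ v → G r * x v ≤ G (r ++ v ∷ [])
      G-append {r} r∈ v m≤v = ≤-trans (≤-reflexive (sum-map-*ʳ _ (x v) (fillings (2 + m) (a ∷ μ))))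
        (sum-map-mono (All.tabulate (λ {t} t∈ → append t (∈-fillings⁻ (a ∷ μ) t∈))))
        where
        append : ∀ t → map length t ≡ a ∷ μ → ssytWeight x (r ∷ t) * x v ≤ ssytWeight x ((r ++ v ∷ []) ∷ t)
        append (s ∷ t) shape =
          ssytWeight-++ x r s t v (trans (∈-words⁻ a r∈) (sym (proj₁ (∷-injective shape)))) m≤v
      G-append-last-two : ∀ {r} → r ∈ words (2 + m) a →
        G r * (x penultimate + x ultimate) ≤ sum (map (λ v → G (r ++ v ∷ [])) (allFin (2 + m)))
      G-append-last-two {r} r∈ = begin
        G r * (x penultimate + x ultimate)
          ≡⟨ *-distribˡ-+ (G r) (x penultimate) (x ultimate) ⟩
        G r * x penultimate + G r * x ultimate
          ≤⟨ +-mono-≤ (G-append r∈ penultimate (≤-reflexive (sym toℕ-penultimate)))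
                      (G-append r∈ ultimate (≤-trans (n≤1+n m) (≤-reflexive (sym (toℕ-fromℕ (suc m)))))) ⟩
        G (r ++ penultimate ∷ []) + G (r ++ ultimate ∷ [])
          ≤⟨ sum-map-≥-pair (λ v → G (r ++ v ∷ [])) (∈-allFin _) (∈-allFin _)
                            (<⇒≢ penultimate<ultimate ∘ cong toℕ) ⟩
        sum (map (λ v → G (r ++ v ∷ [])) (allFin (2 + m)))
          ∎

    to-last-two : ∀ (x : Fin (2 + m) → ℕ) p q → toℕ p < toℕ q →
                  ∃ λ y → SchurEquivalent x y × y penultimate ≡ x p × y ultimate ≡ x q
    to-last-two x p q p<q =
      Moved.y second , (λ μ μ↓ → trans (Moved.equivalent first μ μ↓) (Moved.equivalent second μ μ↓))
      , trans (Moved.arrives second) (Moved.fixes-below first p p<q)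
      , trans (Moved.fixes-above second ultimate penultimate<ultimate) (Moved.arrives first)
      where
      q≤m+1 : toℕ q ≤ suc m
      q≤m+1 = ≤-pred (toℕ<n q)
      first : Moved x q ultimate
      first = move (suc m ∸ toℕ q) x q ultimate (trans (toℕ-fromℕ (suc m)) (sym (m∸n+n≡m q≤m+1)))
      second : Moved (Moved.y first) p penultimate
      second = move (m ∸ toℕ p) (Moved.y first) p penultimate
        (trans toℕ-penultimate (sym (m∸n+n≡m (≤-pred (≤-trans p<q q≤m+1)))))

    schur-append-ordered : ∀ a μ → Linked _≥_ (a ∷ μ) → ∀ (x : Fin (2 + m) → ℕ) p q → toℕ p < toℕ q →
      schur (2 + m) (a ∷ a ∷ μ) x * (x p + x q) ≤ schur (2 + m) (suc a ∷ a ∷ μ) x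
    schur-append-ordered a μ aμ↓ x p q p<q with y , x~y , y-pen , y-ult ← to-last-two x p q p<q = begin
      schur (2 + m) (a ∷ a ∷ μ) x * (x p + x q)
        ≡⟨ cong₂ _*_ (x~y _ (≤-refl ∷ aμ↓)) (sym (cong₂ _+_ y-pen y-ult)) ⟩
      schur (2 + m) (a ∷ a ∷ μ) y * (y penultimate + y ultimate)
        ≤⟨ schur-append-last-two a μ y ⟩
      schur (2 + m) (suc a ∷ a ∷ μ) y
        ≡⟨ x~y _ (n≤1+n a ∷ aμ↓) ⟨
      schur (2 + m) (suc a ∷ a ∷ μ) x
        ∎
      where open ≤-Reasoning

    schur-append-two : ∀ a μ → Linked _≥_ (a ∷ μ) → ∀ (x : Fin (2 + m) → ℕ) p q → p ≢ q →
      schur (2 + m) (a ∷ a ∷ μ) x * (x p + x q) ≤ schur (2 + m) (suc a ∷ a ∷ μ) x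
    schur-append-two a μ aμ↓ x p q p≢q with <-cmp (toℕ p) (toℕ q)
    ... | tri< p<q _ _ = schur-append-ordered a μ aμ↓ x p q p<q
    ... | tri≈ _ p≡q _ = ⊥-elim (p≢q (toℕ-injective p≡q))
    ... | tri> _ _ q<p = subst (λ s → schur (2 + m) (a ∷ a ∷ μ) x * s ≤ schur (2 + m) (suc a ∷ a ∷ μ) x)
                               (+-comm (x q) (x p)) (schur-append-ordered a μ aμ↓ x q p q<p)

  staircase-decreasing : ∀ m → Linked _≥_ (m ∷ downFrom m)
  staircase-decreasing zero    = [-]
  staircase-decreasing (suc m) = n≤1+n m ∷ staircase-decreasing m

open Schur using (schur-append-two; staircase-decreasing)

open import Data.Nat using (ℕ; zero; suc; _+_; _*_; _≤_)
open import Data.Fin using (Fin; zero)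
open import Data.Integer using (ℤ; ∣_∣; +_; _<_)
open import Data.Product using (∃; _×_)
open import Relation.Binary.PropositionalEquality using (_≡_; _≢_; refl)
open import Data.Empty using (⊥-elim)
open import Data.List using (downFrom)

proposition3p3 : (n : ℕ) (A : Fin n → ℤ)
    → (∀ i → A i ≢ + 0)
    → gcdVec A ≡ 1
    → (∃ λ i → + 0 < A i)
    → (∃ λ j → A j < + 0)
    → (i₀ i₁ : Fin n) → i₀ ≢ i₁
    → (∀ k → k ≢ i₀ → k ≢ i₁ → ∣ A k ∣ ≤ ∣ A i₀ ∣ × ∣ A k ∣ ≤ ∣ A i₁ ∣)
    → schur n (shapeNum n) (λ i → ∣ A i ∣) * (∣ A i₀ ∣ + ∣ A i₁ ∣)
        ≤ schur n (staircase n) (λ i → ∣ A i ∣)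
proposition3p3 zero          _ _ _ _ _ ()   _    _     _
proposition3p3 (suc zero)    _ _ _ _ _ zero zero i₀≢i₁ _ = ⊥-elim (i₀≢i₁ refl)
proposition3p3 (suc (suc m)) A _ _ _ _ i₀   i₁   i₀≢i₁ _ =
  schur-append-two m (downFrom m) (staircase-decreasing m) (λ i → ∣ A i ∣) i₀ i₁ i₀≢i₁
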